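{- Let $a,b,d$ be positive integers and $K=\mathbb{Q}\bigl(\sqrt{ -a-b\sqrt d}\bigr)$, and assume: (i) $d\equiv 1\pmod 4$ is squarefree; (ii) $a^2-b^2d=c^2d$ for some integer $c>0$ (equivalently, $K/\mathbb{Q}$ is cyclic); (iii) for $\epsilon=1$ or $\epsilon=-1$, the set $$\Bigl\{1,\ \tfrac{1+\sqrt d}{2},\ \tfrac14\bigl(1+\sqrt d+\sqrt{ -a-b\sqrt d}+\epsilon\sqrt{ -a+b\sqrt d}\bigr),\ \tfrac14\bigl(1-\sqrt d+\sqrt{ -a-b\sqrt d}-\epsilon\sqrt{ -a+b\sqrt d}\bigr)\Bigr\}$$ is an integral basis of $K$. Then $\operatorname{disc}(K)=a^2d$.
   Context: Here $\sqrt{ -a+b\sqrt d}$ denotes a suitable element of $K$ whose square is $-a+b\sqrt d$ (it lies in $K$ since $K$ is cyclic), and $\operatorname{disc}(K)$ is the absolute discriminant of $K$. -}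

module Defs where

open import Data.Nat as ℕ using (ℕ; zero; suc; NonZero)
open import Data.Integer as ℤ using (ℤ; +_)
open import Data.Rational as ℚ using (ℚ; 0ℚ; 1ℚ; _/_)
open import Data.Fin using (Fin; zero; suc; toℕ; punchIn)
open import Data.List using (List; []; _∷_; map; foldr; _++_)
open import Data.List using () renaming (allFin to allFinL)
open import Data.Product using (Σ; _×_; _,_)
open import Relation.Binary.PropositionalEquality using (_≡_; _≢_)

open import Data.Nat.Divisibility using (_∣_)
SquareFree : ℕ → Set
SquareFree n = ∀ m → (m ℕ.* m) ∣ n → m ≡ 1

ℤ→ℚ : ℤ → ℚ
ℤ→ℚ n = n / 1

-- Element x0 + x1·√d + x2·α + x3·√d·α of the quartic algebra
-- ℚ(√d)(α) with α² = -a - b√d (so α = √(-a-b√d)).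
record K : Set where
  constructor mkK
  field
    k0 k1 k2 k3 : ℚ
open K public

module Arith (a b d : ℕ) where
  mulQd : ℚ × ℚ → ℚ × ℚ → ℚ × ℚ
  mulQd (p , q) (r , s) = (p ℚ.* r ℚ.+ ℤ→ℚ (+ d) ℚ.* q ℚ.* s , p ℚ.* s ℚ.+ q ℚ.* r)

  addQd : ℚ × ℚ → ℚ × ℚ → ℚ × ℚ
  addQd (p , q) (r , s) = (p ℚ.+ r , q ℚ.+ s)

  αsq : ℚ × ℚ
  αsq = (ℚ.- ℤ→ℚ (+ a) , ℚ.- ℤ→ℚ (+ b))

  _+K_ : K → K → K
  mkK x0 x1 x2 x3 +K mkK y0 y1 y2 y3 =
    mkK (x0 ℚ.+ y0) (x1 ℚ.+ y1) (x2 ℚ.+ y2) (x3 ℚ.+ y3)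

  _*K_ : K → K → K
  mkK x0 x1 x2 x3 *K mkK y0 y1 y2 y3 =
    let u  = (x0 , x1) ; v  = (x2 , x3)
        u' = (y0 , y1) ; v' = (y2 , y3)
        (r0 , r1) = addQd (mulQd u u') (mulQd αsq (mulQd v v'))
        (r2 , r3) = addQd (mulQd u v') (mulQd v u')
    in mkK r0 r1 r2 r3

  infixl 6 _+K_
  infixl 7 _*K_

  _•_ : ℚ → K → K
  q • mkK x0 x1 x2 x3 = mkK (q ℚ.* x0) (q ℚ.* x1) (q ℚ.* x2) (q ℚ.* x3)
  infixr 7 _•_

  0K 1K sqrtd alpha : K
  0K = mkK 0ℚ 0ℚ 0ℚ 0ℚ
  1K = mkK 1ℚ 0ℚ 0ℚ 0ℚ
  sqrtd = mkK 0ℚ 1ℚ 0ℚ 0ℚ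
  alpha = mkK 0ℚ 0ℚ 1ℚ 0ℚ

  e : Fin 4 → K
  e zero = 1K
  e (suc zero) = sqrtd
  e (suc (suc zero)) = alpha
  e (suc (suc (suc zero))) = sqrtd *K alpha

  coord : Fin 4 → K → ℚ
  coord zero = k0
  coord (suc zero) = k1
  coord (suc (suc zero)) = k2
  coord (suc (suc (suc zero))) = k3

  sumQ : List ℚ → ℚ
  sumQ = foldr ℚ._+_ 0ℚ

  sumK : List K → K
  sumK = foldr _+K_ 0K

  Tr : K → ℚ
  Tr z = sumQ (map (λ i → coord i (z *K e i)) (allFinL 4))

  IsField : Set
  IsField = ∀ z → z ≢ 0K → Σ K λ w → z *K w ≡ 1K

  -- value of the monic polynomial X^n + c_{n-1} X^{n-1} + ... + c_0
  -- with coefficient list [c_0, ..., c_{n-1}] at z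
  horner : List ℤ → K → K
  horner [] z = 0K
  horner (c ∷ cs) z = (ℤ→ℚ c • 1K) +K z *K horner cs z

  evalMonic : List ℤ → K → K
  evalMonic cs z = horner (cs ++ (+ 1 ∷ [])) z

  IsAlgInt : K → Set
  IsAlgInt z = Σ (List ℤ) λ cs → evalMonic cs z ≡ 0K

  lincomb : (Fin 4 → ℤ) → (Fin 4 → K) → K
  lincomb n w = sumK (map (λ i → ℤ→ℚ (n i) • w i) (allFinL 4))

  IsIntegralBasis : (Fin 4 → K) → Set
  IsIntegralBasis w =
    (∀ i → IsAlgInt (w i))
    × (∀ z → IsAlgInt z → Σ (Fin 4 → ℤ) λ n → z ≡ lincomb n w)
    × (∀ n → lincomb n w ≡ 0K → ∀ i → n i ≡ + 0)

sgn : ℕ → ℚ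
sgn zero = 1ℚ
sgn (suc k) = ℚ.- sgn k

det : ∀ n → (Fin n → Fin n → ℚ) → ℚ
det zero M = 1ℚ
det (suc n) M =
  foldr ℚ._+_ 0ℚ
    (map (λ j → sgn (toℕ j) ℚ.* M zero j ℚ.* det n (λ r c → M (suc r) (punchIn j c)))
         (allFinL (suc n)))

module Disc (a b d : ℕ) where
  open Arith a b d
  disc : (Fin 4 → K) → ℚ
  disc w = det 4 (λ i j → Tr (w i *K w j))

-- The specific elements: β = √(-a+b√d) := c√d/α = (b/c)·α - (a/(cd))·√d·α
module Basis (a b c d : ℕ) .{{_ : NonZero c}} .{{_ : NonZero d}} where
  open Arith a b d
  beta : K
  beta = mkK 0ℚ 0ℚ (+ b / c) (ℚ.- ((+ a / c) ℚ.* (+ 1 / d)))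

  quarter : ℚ
  quarter = + 1 / 4

  W : ℤ → Fin 4 → K
  W ε zero = 1K
  W ε (suc zero) = (+ 1 / 2) • (1K +K sqrtd)
  W ε (suc (suc zero)) =
    quarter • (1K +K sqrtd +K alpha +K ℤ→ℚ ε • beta)
  W ε (suc (suc (suc zero))) =
    quarter • (1K +K (ℚ.- 1ℚ) • sqrtd +K alpha +K (ℚ.- ℤ→ℚ ε) • beta)

module Submission where

open import Defs
open import Algebra.Bundles.Raw using (RawRing)
open import Data.Nat using (ℕ; NonZero)
open import Data.Integer using (ℤ; +_; -[1+_])
open import Data.Rational using (ℚ)
open import Data.Fin using (Fin)
open import Data.Sum using (_⊎_)
open import Relation.Binary.PropositionalEquality using (_≡_)

-- Each element of one integral basis is an integral combination of the elements of
-- another, so the coordinate matrices C, C′ of two integral bases (with respect to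
-- 1, √d, α, √d·α) satisfy C′ = M C and C = N C′ with integer matrices M, N.  Then
-- det M · det N = 1, so det M = ±1, and the discriminant det (C T Cᵀ) = det T · (det C)²,
-- T the Gram matrix of the trace form, is the same for all integral bases.  For the
-- basis of (iii), det C = −εr/16 where r = −a/(cd) is the √d·α-coordinate of
-- √(−a+b√d), and det T = 256 d² (a² − b²d) = 256 c²d³, which gives a²d.

module IntegerCast where
  open import Data.Nat as ℕ using (suc)
  import Data.Nat.Properties as ℕ
  import Data.Nat.Coprimality as Coprimality
  open import Data.Integer as ℤ using (+[1+_])
  import Data.Integer.Properties as ℤ
  open import Data.Rational as ℚ using (mkℚ; 1ℚ)
  import Data.Rational.Properties as ℚ
  open import Data.Rational.Unnormalised as ℚᵘ using (mkℚᵘ; *≡*)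
  import Data.Rational.Unnormalised.Properties as ℚᵘ
  open import Relation.Binary.PropositionalEquality

  ℤ→ℚ≡mkℚ : ∀ i → ℤ→ℚ i ≡ mkℚ i 0 (Coprimality.sym (Coprimality.1-coprimeTo ℤ.∣ i ∣))
  ℤ→ℚ≡mkℚ i = ℚ.↥p/↧p≡p (mkℚ i 0 _)

  ℤ→ℚ-homo-+ : ∀ i j → ℤ→ℚ (i ℤ.+ j) ≡ ℤ→ℚ i ℚ.+ ℤ→ℚ j
  ℤ→ℚ-homo-+ i j rewrite ℤ→ℚ≡mkℚ i | ℤ→ℚ≡mkℚ j =
    cong (ℚ._/ 1) (sym (cong₂ ℤ._+_ (ℤ.*-identityʳ i) (ℤ.*-identityʳ j)))

  ℤ→ℚ-homo-* : ∀ i j → ℤ→ℚ (i ℤ.* j) ≡ ℤ→ℚ i ℚ.* ℤ→ℚ j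
  ℤ→ℚ-homo-* i j rewrite ℤ→ℚ≡mkℚ i | ℤ→ℚ≡mkℚ j = refl

  ℤ→ℚ-homo‿- : ∀ i → ℤ→ℚ (ℤ.- i) ≡ ℚ.- ℤ→ℚ i
  ℤ→ℚ-homo‿- i rewrite ℤ→ℚ≡mkℚ i = sym (neg-mkℚ i)
    where
    neg-mkℚ : ∀ i .{c : Coprimality.Coprime ℤ.∣ i ∣ 1} → ℚ.- mkℚ i 0 c ≡ ℤ→ℚ (ℤ.- i)
    neg-mkℚ (+ 0)    = refl
    neg-mkℚ +[1+ n ] = sym (ℤ→ℚ≡mkℚ -[1+ n ])
    neg-mkℚ -[1+ n ] = sym (ℤ→ℚ≡mkℚ +[1+ n ])

  ℤ→ℚ-injective : ∀ {i j} → ℤ→ℚ i ≡ ℤ→ℚ j → i ≡ j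
  ℤ→ℚ-injective {i} {j} eq = cong ℚ.↥_ (trans (sym (ℤ→ℚ≡mkℚ i)) (trans eq (ℤ→ℚ≡mkℚ j)))

  ℤ→ℚ-homo-ℕ* : ∀ m n → ℤ→ℚ (+ (m ℕ.* n)) ≡ ℤ→ℚ (+ m) ℚ.* ℤ→ℚ (+ n)
  ℤ→ℚ-homo-ℕ* m n = trans (cong ℤ→ℚ (ℤ.pos-* m n)) (ℤ→ℚ-homo-* (+ m) (+ n))

  ℤ→ℚ-square-* : ∀ m n → ℤ→ℚ (+ (m ℕ.* m ℕ.* n)) ≡ ℤ→ℚ (+ m) ℚ.* ℤ→ℚ (+ m) ℚ.* ℤ→ℚ (+ n)
  ℤ→ℚ-square-* m n = trans (ℤ→ℚ-homo-ℕ* (m ℕ.* m) n) (cong (ℚ._* ℤ→ℚ (+ n)) (ℤ→ℚ-homo-ℕ* m m))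

  /-*-cancel : ∀ i n .{{_ : NonZero n}} → (i ℚ./ n) ℚ.* ℤ→ℚ (+ n) ≡ ℤ→ℚ i
  /-*-cancel i (suc n) = ℚ.toℚᵘ-injective (begin
    ℚ.toℚᵘ ((i ℚ./ suc n) ℚ.* ℤ→ℚ (+ suc n))          ≈⟨ ℚ.toℚᵘ-homo-* (i ℚ./ suc n) (ℤ→ℚ (+ suc n)) ⟩
    ℚ.toℚᵘ (i ℚ./ suc n) ℚᵘ.* ℚ.toℚᵘ (ℤ→ℚ (+ suc n))  ≈⟨ ℚᵘ.*-cong (ℚ.toℚᵘ-fromℚᵘ (mkℚᵘ i n))
                                                                    (ℚ.toℚᵘ-fromℚᵘ (mkℚᵘ (+ suc n) 0)) ⟩
    mkℚᵘ i n ℚᵘ.* mkℚᵘ (+ suc n) 0                    ≈⟨ *≡* cross-multiplied ⟩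
    mkℚᵘ i 0                                          ≈⟨ ℚ.toℚᵘ-fromℚᵘ (mkℚᵘ i 0) ⟨
    ℚ.toℚᵘ (ℤ→ℚ i)                                    ∎)
    where
    open ℚᵘ.≃-Reasoning
    cross-multiplied : (i ℤ.* + suc n) ℤ.* + 1 ≡ i ℤ.* + suc (n ℕ.* 1)
    cross-multiplied rewrite ℕ.*-identityʳ n = ℤ.*-identityʳ _

  ℤ→ℚ-unit-square : ∀ i j → ℤ→ℚ i ℚ.* ℤ→ℚ j ≡ 1ℚ → ℤ→ℚ i ℚ.* ℤ→ℚ i ≡ 1ℚ
  ℤ→ℚ-unit-square i j ij≡1
    with ℕ.m*n≡1⇒m≡1 ℤ.∣ i ∣ ℤ.∣ j ∣
           (trans (sym (ℤ.abs-* i j))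
             (cong ℤ.∣_∣ (ℤ→ℚ-injective {i ℤ.* j} {+ 1} (trans (ℤ→ℚ-homo-* i j) ij≡1))))
  ℤ→ℚ-unit-square (+ 1)    j ij≡1 | refl = refl
  ℤ→ℚ-unit-square -[1+ 0 ] j ij≡1 | refl = refl

module Matrices {c ℓ} (R : RawRing c ℓ) where
  open RawRing R
  open import Data.Nat using (zero; suc)
  open import Data.Fin using (zero; suc; toℕ; punchIn)
  open import Data.List using ([]; _∷_; map; foldr; allFin)
  open import Relation.Binary.PropositionalEquality using (refl; cong₂)

  Matrix : ℕ → Set c
  Matrix n = Fin n → Fin n → Carrier

  sumFin : ∀ n → (Fin n → Carrier) → Carrier
  sumFin n f = foldr _+_ 0# (map f (allFin n))

  sumFin-cong : ∀ n {f g : Fin n → Carrier} → (∀ j → f j ≡ g j) → sumFin n f ≡ sumFin n g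
  sumFin-cong n {f} {g} f≗g = go (allFin n)
    where
    go : ∀ js → foldr _+_ 0# (map f js) ≡ foldr _+_ 0# (map g js)
    go []       = refl
    go (j ∷ js) = cong₂ _+_ (f≗g j) (go js)

  infixl 7 _·_
  _·_ : ∀ {n} → Matrix n → Matrix n → Matrix n
  (M · N) i j = sumFin _ (λ k → M i k * N k j)

  _ᵀ : ∀ {n} → Matrix n → Matrix n
  (M ᵀ) i j = M j i

  sign : ℕ → Carrier
  sign zero    = 1#
  sign (suc k) = - sign k

  determinant : ∀ n → Matrix n → Carrier
  determinant zero    M = 1#
  determinant (suc n) M =
    sumFin (suc n) (λ j → sign (toℕ j) * M zero j * determinant n (λ r c → M (suc r) (punchIn j c)))

-- Arith and Basis of Defs, transcribed over an arbitrary raw ring with the rational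
-- constants embedded by κ.  Over the ring of ring-solver expressions, evaluating one of
-- these symbolic computations gives, definitionally, the corresponding computation of Defs;
-- this is how the solver proves the identities about Tr and det below.
module QuarticArithmetic {c ℓ} (R : RawRing c ℓ) (κ : ℚ → RawRing.Carrier R) where
  open RawRing R
  open import Data.Fin using (zero; suc)
  open import Data.Product using (_×_; _,_)
  open import Data.Rational as ℚ using (_/_)
  open Matrices R using (Matrix; sumFin)

  record Quartic : Set c where
    constructor quartic
    field
      q₀ q₁ q₂ q₃ : Carrier
  open Quartic

  infixl 6 _⊞_
  infixr 7 _•_

  _⊞_ : Quartic → Quartic → Quartic
  quartic x₀ x₁ x₂ x₃ ⊞ quartic y₀ y₁ y₂ y₃ = quartic (x₀ + y₀) (x₁ + y₁) (x₂ + y₂) (x₃ + y₃)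

  _•_ : Carrier → Quartic → Quartic
  s • quartic x₀ x₁ x₂ x₃ = quartic (s * x₀) (s * x₁) (s * x₂) (s * x₃)

  one √d α : Quartic
  one = quartic 1# 0# 0# 0#
  √d  = quartic 0# 1# 0# 0#
  α   = quartic 0# 0# 1# 0#

  component : Fin 4 → Quartic → Carrier
  component zero                   = q₀
  component (suc zero)             = q₁
  component (suc (suc zero))       = q₂
  component (suc (suc (suc zero))) = q₃

  components : (Fin 4 → Quartic) → Matrix 4
  components w i k = component k (w i)

  candidateBasis : (p r e : Carrier) → Fin 4 → Quartic
  candidateBasis p r e zero                   = one
  candidateBasis p r e (suc zero)             = κ (+ 1 / 2) • (one ⊞ √d)
  candidateBasis p r e (suc (suc zero))       = κ (+ 1 / 4) • (one ⊞ √d ⊞ α ⊞ e • β)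
    where β = quartic 0# 0# p r
  candidateBasis p r e (suc (suc (suc zero))) = κ (+ 1 / 4) • (one ⊞ (- 1#) • √d ⊞ α ⊞ (- e) • β)
    where β = quartic 0# 0# p r

  -- Gram matrix of (x, y) ↦ Tr (x y) in the basis 1, √d, α, √d·α, where α² = −A − B√d;
  -- of the basis elements only 1 has nonzero trace.
  traceMatrix : (A B D : Carrier) → Matrix 4
  traceMatrix A B D zero                   zero                   = κ (+ 4 / 1)
  traceMatrix A B D (suc zero)             (suc zero)             = κ (+ 4 / 1) * D
  traceMatrix A B D (suc (suc zero))       (suc (suc zero))       = - (κ (+ 4 / 1) * A)
  traceMatrix A B D (suc (suc zero))       (suc (suc (suc zero))) = - (κ (+ 4 / 1) * B * D)
  traceMatrix A B D (suc (suc (suc zero))) (suc (suc zero))       = - (κ (+ 4 / 1) * B * D)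
  traceMatrix A B D (suc (suc (suc zero))) (suc (suc (suc zero))) = - (κ (+ 4 / 1) * A * D)
  traceMatrix A B D _                      _                      = 0#

  module WithStructureConstants (A B D : Carrier) where
    infixl 7 _⊠_

    mulQd : Carrier × Carrier → Carrier × Carrier → Carrier × Carrier
    mulQd (p , q) (r , s) = (p * r + D * q * s , p * s + q * r)

    addQd : Carrier × Carrier → Carrier × Carrier → Carrier × Carrier
    addQd (p , q) (r , s) = (p + r , q + s)

    _⊠_ : Quartic → Quartic → Quartic
    quartic x₀ x₁ x₂ x₃ ⊠ quartic y₀ y₁ y₂ y₃ =
      let (r₀ , r₁) = addQd (mulQd (x₀ , x₁) (y₀ , y₁)) (mulQd (- A , - B) (mulQd (x₂ , x₃) (y₂ , y₃)))
          (r₂ , r₃) = addQd (mulQd (x₀ , x₁) (y₂ , y₃)) (mulQd (x₂ , x₃) (y₀ , y₁))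
      in quartic r₀ r₁ r₂ r₃

    powerBasis : Fin 4 → Quartic
    powerBasis zero                   = one
    powerBasis (suc zero)             = √d
    powerBasis (suc (suc zero))       = α
    powerBasis (suc (suc (suc zero))) = √d ⊠ α

    trace : Quartic → Carrier
    trace z = sumFin 4 (λ i → component i (z ⊠ powerBasis i))

module Symbolic where
  open import Level using (0ℓ)
  open import Data.Rational as ℚ using (0ℚ; 1ℚ)
  import Data.Rational.Properties as ℚ
  open import Relation.Nullary.Decidable using (dec⇒maybe)
  open import Tactic.RingSolver.Core.AlmostCommutativeRing using (AlmostCommutativeRing; fromCommutativeRing)

  ℚ-ring : AlmostCommutativeRing 0ℓ 0ℓ
  ℚ-ring = fromCommutativeRing ℚ.+-*-commutativeRing (λ x → dec⇒maybe (0ℚ ℚ.≟ x))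

  open import Tactic.RingSolver.NonReflective ℚ-ring public using (Expr; Κ; Ι; _⊕_; _⊗_; ⊝_; module Ops)

  expressionRing : ℕ → RawRing 0ℓ 0ℓ
  expressionRing n = record
    { Carrier = Expr ℚ n ; _≈_ = _≡_ ; _+_ = _⊕_ ; _*_ = _⊗_ ; -_ = ⊝_ ; 0# = Κ 0ℚ ; 1# = Κ 1ℚ }

  module Over (n : ℕ) where
    open Matrices (expressionRing n) public
    open QuarticArithmetic (expressionRing n) Κ public

module Determinant where
  open import Data.Nat using (zero; suc)
  open import Data.Fin using (zero; suc; toℕ; punchIn; combine; remQuot; _↑ˡ_; _↑ʳ_)
  open import Data.Product using (uncurry)
  open import Data.Vec using (Vec; tabulate; _++_)
  open import Data.Rational as ℚ using ()
  import Data.Rational.Properties as ℚ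
  open import Relation.Binary.PropositionalEquality using (refl; cong; cong₂)
  open Symbolic
  open Matrices ℚ.+-*-rawRing using (Matrix; sumFin-cong; _·_; _ᵀ)

  det-cong : ∀ n {M N : Matrix n} → (∀ i j → M i j ≡ N i j) → det n M ≡ det n N
  det-cong zero    M≗N = refl
  det-cong (suc n) M≗N = sumFin-cong (suc n) λ j →
    cong₂ ℚ._*_ (cong (sgn (toℕ j) ℚ.*_) (M≗N zero j)) (det-cong n λ r c → M≗N (suc r) (punchIn j c))

  entries : Matrix 4 → Vec ℚ 16
  entries M = tabulate (λ k → uncurry M (remQuot 4 k))

  det-· : ∀ M N → det 4 (M · N) ≡ det 4 M ℚ.* det 4 N
  det-· M N = Ops.prove (entries M ++ entries N)
    (S.determinant 4 (X S.· Y)) (S.determinant 4 X ⊗ S.determinant 4 Y) refl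
    where
    module S = Over 32
    X Y : S.Matrix 4
    X i j = Ι (combine i j ↑ˡ 16)
    Y i j = Ι (16 ↑ʳ combine i j)

  det-ᵀ : ∀ M → det 4 (M ᵀ) ≡ det 4 M
  det-ᵀ M = Ops.prove (entries M) (S.determinant 4 (X S.ᵀ)) (S.determinant 4 X) refl
    where
    module S = Over 16
    X : S.Matrix 4
    X i j = Ι (combine i j)

module IntegerMatrices where
  open import Data.Nat using (zero; suc)
  open import Data.Fin using (zero; suc; toℕ; punchIn)
  open import Data.List using (map; foldr; allFin; []; _∷_)
  open import Data.Integer as ℤ using ()
  import Data.Integer.Properties as ℤ
  open import Data.Rational as ℚ using ()
  import Data.Rational.Properties as ℚ
  open import Relation.Binary.PropositionalEquality using (refl; cong; cong₂; trans)
  open IntegerCast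
  module ℤM = Matrices ℤ.+-*-rawRing
  module ℚM = Matrices ℚ.+-*-rawRing

  toℚMatrix : ∀ {n} → ℤM.Matrix n → ℚM.Matrix n
  toℚMatrix M i j = ℤ→ℚ (M i j)

  ℤ→ℚ-sumFin : ∀ n (f : Fin n → ℤ) → ℤ→ℚ (ℤM.sumFin n f) ≡ ℚM.sumFin n (λ j → ℤ→ℚ (f j))
  ℤ→ℚ-sumFin n f = go (allFin n)
    where
    go : ∀ js → ℤ→ℚ (foldr ℤ._+_ (+ 0) (map f js)) ≡ foldr ℚ._+_ ℚ.0ℚ (map (λ j → ℤ→ℚ (f j)) js)
    go []       = refl
    go (j ∷ js) = trans (ℤ→ℚ-homo-+ (f j) _) (cong (ℤ→ℚ (f j) ℚ.+_) (go js))

  ℤ→ℚ-sign : ∀ k → ℤ→ℚ (ℤM.sign k) ≡ sgn k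
  ℤ→ℚ-sign zero    = refl
  ℤ→ℚ-sign (suc k) = trans (ℤ→ℚ-homo‿- (ℤM.sign k)) (cong ℚ.-_ (ℤ→ℚ-sign k))

  ℤ→ℚ-det : ∀ n (M : ℤM.Matrix n) → ℤ→ℚ (ℤM.determinant n M) ≡ det n (toℚMatrix M)
  ℤ→ℚ-det zero    M = refl
  ℤ→ℚ-det (suc n) M = trans (ℤ→ℚ-sumFin (suc n) expansion) (ℚM.sumFin-cong (suc n) λ j →
    trans (ℤ→ℚ-homo-* (ℤM.sign (toℕ j) ℤ.* M zero j) (minor j))
      (cong₂ ℚ._*_
        (trans (ℤ→ℚ-homo-* (ℤM.sign (toℕ j)) (M zero j)) (cong (ℚ._* ℤ→ℚ (M zero j)) (ℤ→ℚ-sign (toℕ j))))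
        (ℤ→ℚ-det n _)))
    where
    minor : Fin (suc n) → ℤ
    minor j = ℤM.determinant n (λ r c → M (suc r) (punchIn j c))
    expansion : Fin (suc n) → ℤ
    expansion j = ℤM.sign (toℕ j) ℤ.* M zero j ℤ.* minor j

module UnimodularChange where
  open import Data.Rational as ℚ using (0ℚ; 1ℚ)
  import Data.Rational.Properties as ℚ
  open import Relation.Binary.PropositionalEquality
  open import Tactic.RingSolver using (solve-∀)
  open Symbolic using (ℚ-ring)
  open IntegerCast
  open IntegerMatrices
  open Determinant

  x≡y*x⇒y≡1 : ∀ x y → x ≢ 0ℚ → x ≡ y ℚ.* x → y ≡ 1ℚ
  x≡y*x⇒y≡1 x y x≢0 x≡yx = let instance _ = ℚ.≢-nonZero x≢0 in begin
    y                      ≡⟨ ℚ.*-identityʳ y ⟨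
    y ℚ.* 1ℚ               ≡⟨ cong (y ℚ.*_) (ℚ.*-inverseʳ x) ⟨
    y ℚ.* (x ℚ.* ℚ.1/ x)   ≡⟨ ℚ.*-assoc y x (ℚ.1/ x) ⟨
    y ℚ.* x ℚ.* ℚ.1/ x     ≡⟨ cong (ℚ._* ℚ.1/ x) x≡yx ⟨
    x ℚ.* ℚ.1/ x           ≡⟨ ℚ.*-inverseʳ x ⟩
    1ℚ                     ∎
    where open ≡-Reasoning

  det²-unimodular-invariant : (M N : ℤM.Matrix 4) (C D : ℚM.Matrix 4)
    → (∀ i k → D i k ≡ (toℚMatrix M ℚM.· C) i k) → (∀ i k → C i k ≡ (toℚMatrix N ℚM.· D) i k)
    → det 4 C ≢ 0ℚ → det 4 D ℚ.* det 4 D ≡ det 4 C ℚ.* det 4 C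
  det²-unimodular-invariant M N C D D≡MC C≡ND detC≢0 = begin
    det 4 D ℚ.* det 4 D                   ≡⟨ cong₂ ℚ._*_ detD≡mc detD≡mc ⟩
    (m ℚ.* det 4 C) ℚ.* (m ℚ.* det 4 C)   ≡⟨ interchange m (det 4 C) ⟩
    (m ℚ.* m) ℚ.* (det 4 C ℚ.* det 4 C)   ≡⟨ cong (ℚ._* (det 4 C ℚ.* det 4 C)) m²≡1 ⟩
    1ℚ ℚ.* (det 4 C ℚ.* det 4 C)          ≡⟨ ℚ.*-identityˡ _ ⟩
    det 4 C ℚ.* det 4 C                   ∎
    where
    open ≡-Reasoning
    interchange : ∀ x y → (x ℚ.* y) ℚ.* (x ℚ.* y) ≡ (x ℚ.* x) ℚ.* (y ℚ.* y)
    interchange = solve-∀ ℚ-ring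
    m n : ℚ
    m = det 4 (toℚMatrix M)
    n = det 4 (toℚMatrix N)
    detD≡mc : det 4 D ≡ m ℚ.* det 4 C
    detD≡mc = trans (det-cong 4 D≡MC) (det-· (toℚMatrix M) C)
    detC≡nmc : det 4 C ≡ (n ℚ.* m) ℚ.* det 4 C
    detC≡nmc = trans (det-cong 4 C≡ND) (trans (det-· (toℚMatrix N) D)
      (trans (cong (n ℚ.*_) detD≡mc) (sym (ℚ.*-assoc n m (det 4 C)))))
    m²≡1 : m ℚ.* m ≡ 1ℚ
    m²≡1 = subst (λ x → x ℚ.* x ≡ 1ℚ) (ℤ→ℚ-det 4 M)
      (ℤ→ℚ-unit-square (ℤM.determinant 4 M) (ℤM.determinant 4 N)
        (subst₂ (λ x y → x ℚ.* y ≡ 1ℚ) (sym (ℤ→ℚ-det 4 M)) (sym (ℤ→ℚ-det 4 N))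
          (trans (ℚ.*-comm m n) (x≡y*x⇒y≡1 (det 4 C) (n ℚ.* m) detC≢0 detC≡nmc))))

module Discriminant where
  open import Function using (id)
  open import Data.Fin using (zero; suc; #_)
  open import Data.Product using (Σ; _,_; proj₁; proj₂)
  open import Data.Vec using ([]; _∷_)
  open import Data.Rational as ℚ using (_/_; 0ℚ)
  import Data.Rational.Properties as ℚ
  open import Relation.Binary.PropositionalEquality using (_≢_; refl; cong; trans; module ≡-Reasoning)
  open import Tactic.RingSolver using (solve-∀)
  open Symbolic
  open Matrices ℚ.+-*-rawRing using (Matrix; sumFin; _·_; _ᵀ)
  open QuarticArithmetic ℚ.+-*-rawRing id using (traceMatrix)
  open Determinant using (det-cong; det-·; det-ᵀ)
  open IntegerMatrices using (module ℤM; toℚMatrix)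
  open UnimodularChange using (det²-unimodular-invariant)

  det-traceMatrix : ∀ A B D → det 4 (traceMatrix A B D) ≡ (+ 256 / 1) ℚ.* D ℚ.* D ℚ.* (A ℚ.* A ℚ.- B ℚ.* B ℚ.* D)
  det-traceMatrix A B D = Ops.prove (A ∷ B ∷ D ∷ [])
    (S.determinant 4 (S.traceMatrix (Ι (# 0)) (Ι (# 1)) (Ι (# 2))))
    (Κ (+ 256 / 1) ⊗ Ι (# 2) ⊗ Ι (# 2) ⊗ (Ι (# 0) ⊗ Ι (# 0) ⊕ ⊝ (Ι (# 1) ⊗ Ι (# 1) ⊗ Ι (# 2))))
    refl
    where module S = Over 3

  module _ (a b d : ℕ) where
    open Arith a b d

    Tr-matrix : Matrix 4
    Tr-matrix = traceMatrix (ℤ→ℚ (+ a)) (ℤ→ℚ (+ b)) (ℤ→ℚ (+ d))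

    coordinates : (Fin 4 → K) → Matrix 4
    coordinates w i k = coord k (w i)

    trace-bilinear : ∀ x y → Tr (x *K y) ≡ sumFin 4 (λ k → coord k x ℚ.* sumFin 4 (λ l → Tr-matrix k l ℚ.* coord l y))
    trace-bilinear x y = Ops.prove
      (ℤ→ℚ (+ a) ∷ ℤ→ℚ (+ b) ∷ ℤ→ℚ (+ d) ∷ k0 x ∷ k1 x ∷ k2 x ∷ k3 x ∷ k0 y ∷ k1 y ∷ k2 y ∷ k3 y ∷ [])
      (trace (X ⊠ Y))
      (S.sumFin 4 (λ k → S.component k X ⊗ S.sumFin 4 (λ l → S.traceMatrix A B D k l ⊗ S.component l Y)))
      refl
      where
      module S = Over 11
      A B D : Expr ℚ 11
      A = Ι (# 0)
      B = Ι (# 1)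
      D = Ι (# 2)
      open S.WithStructureConstants A B D
      X Y : S.Quartic
      X = S.quartic (Ι (# 3)) (Ι (# 4)) (Ι (# 5)) (Ι (# 6))
      Y = S.quartic (Ι (# 7)) (Ι (# 8)) (Ι (# 9)) (Ι (# 10))

    disc≡det-Tr*det² : ∀ w → Disc.disc a b d w
      ≡ det 4 Tr-matrix ℚ.* (det 4 (coordinates w) ℚ.* det 4 (coordinates w))
    disc≡det-Tr*det² w = begin
      Disc.disc a b d w                      ≡⟨ det-cong 4 (λ i j → trace-bilinear (w i) (w j)) ⟩
      det 4 (C · (T · C ᵀ))                  ≡⟨ det-· C (T · C ᵀ) ⟩
      det 4 C ℚ.* det 4 (T · C ᵀ)            ≡⟨ cong (det 4 C ℚ.*_) (det-· T (C ᵀ)) ⟩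
      det 4 C ℚ.* (det 4 T ℚ.* det 4 (C ᵀ))  ≡⟨ cong (λ x → det 4 C ℚ.* (det 4 T ℚ.* x)) (det-ᵀ C) ⟩
      det 4 C ℚ.* (det 4 T ℚ.* det 4 C)      ≡⟨ x*[y*x]≡y*[x*x] (det 4 C) (det 4 T) ⟩
      det 4 T ℚ.* (det 4 C ℚ.* det 4 C)      ∎
      where
      open ≡-Reasoning
      C T : Matrix 4
      C = coordinates w
      T = Tr-matrix
      x*[y*x]≡y*[x*x] : ∀ x y → x ℚ.* (y ℚ.* x) ≡ y ℚ.* (x ℚ.* x)
      x*[y*x]≡y*[x*x] = solve-∀ ℚ-ring

    coord-lincomb : ∀ n w k → coord k (lincomb n w) ≡ sumFin 4 (λ l → ℤ→ℚ (n l) ℚ.* coord k (w l))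
    coord-lincomb n w zero                   = refl
    coord-lincomb n w (suc zero)             = refl
    coord-lincomb n w (suc (suc zero))       = refl
    coord-lincomb n w (suc (suc (suc zero))) = refl

    integral-change-of-basis : ∀ {w v} → IsIntegralBasis w → (∀ i → IsAlgInt (v i))
      → Σ (ℤM.Matrix 4) λ M → ∀ i k → coordinates v i k ≡ (toℚMatrix M · coordinates w) i k
    integral-change-of-basis {w} {v} (_ , spans , _) v-integral =
      (λ i → proj₁ (expansion i)) ,
      (λ i k → trans (cong (coord k) (proj₂ (expansion i))) (coord-lincomb (proj₁ (expansion i)) w k))
      where
      expansion : ∀ i → Σ (Fin 4 → ℤ) λ n → v i ≡ lincomb n w
      expansion i = spans (v i) (v-integral i)

    disc-invariant : ∀ {w v} → IsIntegralBasis w → IsIntegralBasis v → det 4 (coordinates w) ≢ 0ℚ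
      → Disc.disc a b d v ≡ Disc.disc a b d w
    disc-invariant {w} {v} w-basis v-basis det≢0 = begin
      Disc.disc a b d v                               ≡⟨ disc≡det-Tr*det² v ⟩
      det 4 Tr-matrix ℚ.* (det 4 Cv ℚ.* det 4 Cv)  ≡⟨ cong (det 4 Tr-matrix ℚ.*_) det²≡ ⟩
      det 4 Tr-matrix ℚ.* (det 4 Cw ℚ.* det 4 Cw)  ≡⟨ disc≡det-Tr*det² w ⟨
      Disc.disc a b d w                               ∎
      where
      open ≡-Reasoning
      Cv Cw : Matrix 4
      Cv = coordinates v
      Cw = coordinates w
      v-in-w : Σ (ℤM.Matrix 4) λ M → ∀ i k → Cv i k ≡ (toℚMatrix M · Cw) i k
      v-in-w = integral-change-of-basis w-basis (proj₁ v-basis)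
      w-in-v : Σ (ℤM.Matrix 4) λ N → ∀ i k → Cw i k ≡ (toℚMatrix N · Cv) i k
      w-in-v = integral-change-of-basis v-basis (proj₁ w-basis)
      det²≡ : det 4 Cv ℚ.* det 4 Cv ≡ det 4 Cw ℚ.* det 4 Cw
      det²≡ = det²-unimodular-invariant (proj₁ v-in-w) (proj₁ w-in-v) Cw Cv (proj₂ v-in-w) (proj₂ w-in-v) det≢0

module DiscriminantValue where
  open import Data.Rational as ℚ using (_/_; 1ℚ)
  open import Relation.Binary.PropositionalEquality
  open import Tactic.RingSolver using (solve-∀)
  open Symbolic using (ℚ-ring)

  discriminant-value : ∀ A B C D e r → e ℚ.* e ≡ 1ℚ → r ℚ.* C ℚ.* D ≡ ℚ.- A
    → A ℚ.* A ≡ B ℚ.* B ℚ.* D ℚ.+ C ℚ.* C ℚ.* D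
    → (+ 256 / 1) ℚ.* D ℚ.* D ℚ.* (A ℚ.* A ℚ.- B ℚ.* B ℚ.* D)
        ℚ.* (ℚ.- ((+ 1 / 16) ℚ.* e ℚ.* r) ℚ.* ℚ.- ((+ 1 / 16) ℚ.* e ℚ.* r))
      ≡ A ℚ.* A ℚ.* D
  discriminant-value A B C D e r e²≡1 rCD≡-A A²≡B²D+C²D = begin
    (+ 256 / 1) ℚ.* D ℚ.* D ℚ.* (A ℚ.* A ℚ.- B ℚ.* B ℚ.* D)
        ℚ.* (ℚ.- ((+ 1 / 16) ℚ.* e ℚ.* r) ℚ.* ℚ.- ((+ 1 / 16) ℚ.* e ℚ.* r))
      ≡⟨ expand A B C D e r ⟩
    (e ℚ.* e) ℚ.* ((r ℚ.* C ℚ.* D) ℚ.* (r ℚ.* C ℚ.* D) ℚ.* D ℚ.+ D ℚ.* D ℚ.* r ℚ.* r ℚ.* (A ℚ.* A ℚ.- S))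
      ≡⟨ cong (λ x → (e ℚ.* e) ℚ.* (x ℚ.* x ℚ.* D ℚ.+ D ℚ.* D ℚ.* r ℚ.* r ℚ.* (A ℚ.* A ℚ.- S))) rCD≡-A ⟩
    (e ℚ.* e) ℚ.* (ℚ.- A ℚ.* ℚ.- A ℚ.* D ℚ.+ D ℚ.* D ℚ.* r ℚ.* r ℚ.* (A ℚ.* A ℚ.- S))
      ≡⟨ cong₂ (λ s x → s ℚ.* (ℚ.- A ℚ.* ℚ.- A ℚ.* D ℚ.+ D ℚ.* D ℚ.* r ℚ.* r ℚ.* (x ℚ.- S))) e²≡1 A²≡B²D+C²D ⟩
    1ℚ ℚ.* (ℚ.- A ℚ.* ℚ.- A ℚ.* D ℚ.+ D ℚ.* D ℚ.* r ℚ.* r ℚ.* (S ℚ.- S))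
      ≡⟨ simplify A D r S ⟩
    A ℚ.* A ℚ.* D
      ∎
    where
    open ≡-Reasoning
    S : ℚ
    S = B ℚ.* B ℚ.* D ℚ.+ C ℚ.* C ℚ.* D
    expand : ∀ A B C D e r →
      (+ 256 / 1) ℚ.* D ℚ.* D ℚ.* (A ℚ.* A ℚ.- B ℚ.* B ℚ.* D)
          ℚ.* (ℚ.- ((+ 1 / 16) ℚ.* e ℚ.* r) ℚ.* ℚ.- ((+ 1 / 16) ℚ.* e ℚ.* r))
        ≡ (e ℚ.* e) ℚ.* ((r ℚ.* C ℚ.* D) ℚ.* (r ℚ.* C ℚ.* D) ℚ.* D
                           ℚ.+ D ℚ.* D ℚ.* r ℚ.* r ℚ.* (A ℚ.* A ℚ.- (B ℚ.* B ℚ.* D ℚ.+ C ℚ.* C ℚ.* D)))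
    expand = solve-∀ ℚ-ring
    simplify : ∀ A D r S → 1ℚ ℚ.* (ℚ.- A ℚ.* ℚ.- A ℚ.* D ℚ.+ D ℚ.* D ℚ.* r ℚ.* r ℚ.* (S ℚ.- S)) ≡ A ℚ.* A ℚ.* D
    simplify = solve-∀ ℚ-ring

module CandidateBasis (a b c d : ℕ) .{{_ : NonZero a}} .{{_ : NonZero c}} .{{_ : NonZero d}} where
  open import Data.Nat as ℕ using ()
  import Data.Nat.Properties as ℕ
  open import Data.Integer as ℤ using ()
  import Data.Integer.Properties as ℤ
  open import Data.Fin using (#_)
  open import Data.Vec using ([]; _∷_)
  open import Data.Sum using (inj₁; inj₂)
  open import Data.Rational as ℚ using (_/_; 0ℚ; 1ℚ)
  import Data.Rational.Properties as ℚ
  open import Relation.Binary.PropositionalEquality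
  open import Tactic.RingSolver using (solve-∀)
  open IntegerCast
  open Symbolic
  open Matrices ℚ.+-*-rawRing using (Matrix)
  open Discriminant
  open DiscriminantValue

  W : ℤ → Fin 4 → K
  W = Basis.W a b c d

  A B C D r : ℚ
  A = ℤ→ℚ (+ a)
  B = ℤ→ℚ (+ b)
  C = ℤ→ℚ (+ c)
  D = ℤ→ℚ (+ d)
  r = ℚ.- ((+ a / c) ℚ.* (+ 1 / d))

  det-coordinates-W : ∀ ε → det 4 (coordinates a b d (W ε)) ≡ ℚ.- ((+ 1 / 16) ℚ.* ℤ→ℚ ε ℚ.* r)
  det-coordinates-W ε = Ops.prove (+ b / c ∷ r ∷ ℤ→ℚ ε ∷ [])
    (S.determinant 4 (S.components (S.candidateBasis (Ι (# 0)) (Ι (# 1)) (Ι (# 2)))))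
    (⊝ (Κ (+ 1 / 16) ⊗ Ι (# 2) ⊗ Ι (# 1)))
    refl
    where module S = Over 3

  r*C*D≡-A : r ℚ.* C ℚ.* D ≡ ℚ.- A
  r*C*D≡-A = begin
    r ℚ.* C ℚ.* D                                  ≡⟨ regroup (+ a / c) (+ 1 / d) C D ⟩
    ℚ.- (((+ a / c) ℚ.* C) ℚ.* ((+ 1 / d) ℚ.* D))  ≡⟨ cong₂ (λ x y → ℚ.- (x ℚ.* y)) (/-*-cancel (+ a) c) (/-*-cancel (+ 1) d) ⟩
    ℚ.- (A ℚ.* 1ℚ)                                 ≡⟨ cong ℚ.-_ (ℚ.*-identityʳ A) ⟩
    ℚ.- A                                          ∎
    where
    open ≡-Reasoning
    regroup : ∀ p q x y → ℚ.- (p ℚ.* q) ℚ.* x ℚ.* y ≡ ℚ.- ((p ℚ.* x) ℚ.* (q ℚ.* y))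
    regroup = solve-∀ ℚ-ring

  A²≡B²D+C²D : a ℕ.* a ≡ b ℕ.* b ℕ.* d ℕ.+ c ℕ.* c ℕ.* d → A ℚ.* A ≡ B ℚ.* B ℚ.* D ℚ.+ C ℚ.* C ℚ.* D
  A²≡B²D+C²D hyp = begin
    A ℚ.* A                                              ≡⟨ ℤ→ℚ-homo-ℕ* a a ⟨
    ℤ→ℚ (+ (a ℕ.* a))                                    ≡⟨ cong (λ n → ℤ→ℚ (+ n)) hyp ⟩
    ℤ→ℚ (+ (b ℕ.* b ℕ.* d) ℤ.+ + (c ℕ.* c ℕ.* d))        ≡⟨ ℤ→ℚ-homo-+ (+ (b ℕ.* b ℕ.* d)) (+ (c ℕ.* c ℕ.* d)) ⟩
    ℤ→ℚ (+ (b ℕ.* b ℕ.* d)) ℚ.+ ℤ→ℚ (+ (c ℕ.* c ℕ.* d))  ≡⟨ cong₂ ℚ._+_ (ℤ→ℚ-square-* b d) (ℤ→ℚ-square-* c d) ⟩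
    B ℚ.* B ℚ.* D ℚ.+ C ℚ.* C ℚ.* D                      ∎
    where open ≡-Reasoning

  sign-square : ∀ ε → ε ≡ + 1 ⊎ ε ≡ -[1+ 0 ] → ℤ→ℚ ε ℚ.* ℤ→ℚ ε ≡ 1ℚ
  sign-square _ (inj₁ refl) = refl
  sign-square _ (inj₂ refl) = refl

  det-coordinates-W≢0 : ∀ ε → ε ≡ + 1 ⊎ ε ≡ -[1+ 0 ] → det 4 (coordinates a b d (W ε)) ≢ 0ℚ
  det-coordinates-W≢0 ε ±1 det≡0 = ℕ.≢-nonZero⁻¹ a (ℤ.+-injective (ℤ→ℚ-injective A≡0))
    where
    open ≡-Reasoning
    e scale : ℚ
    e = ℤ→ℚ ε
    scale = (+ 16 / 1) ℚ.* e ℚ.* C ℚ.* D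
    regroup : ∀ e r x y → ℚ.- ((+ 1 / 16) ℚ.* e ℚ.* r) ℚ.* ((+ 16 / 1) ℚ.* e ℚ.* x ℚ.* y)
                        ≡ ℚ.- ((e ℚ.* e) ℚ.* (r ℚ.* x ℚ.* y))
    regroup = solve-∀ ℚ-ring
    x≡-[1*-x] : ∀ x → x ≡ ℚ.- (1ℚ ℚ.* ℚ.- x)
    x≡-[1*-x] = solve-∀ ℚ-ring
    A≡0 : A ≡ 0ℚ
    A≡0 = begin
      A                                       ≡⟨ x≡-[1*-x] A ⟩
      ℚ.- (1ℚ ℚ.* ℚ.- A)                      ≡⟨ cong₂ (λ x y → ℚ.- (x ℚ.* y)) (sign-square ε ±1) r*C*D≡-A ⟨
      ℚ.- ((e ℚ.* e) ℚ.* (r ℚ.* C ℚ.* D))     ≡⟨ regroup e r C D ⟨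
      ℚ.- ((+ 1 / 16) ℚ.* e ℚ.* r) ℚ.* scale  ≡⟨ cong (ℚ._* scale) (trans (sym (det-coordinates-W ε)) det≡0) ⟩
      0ℚ ℚ.* scale                            ≡⟨ ℚ.*-zeroˡ scale ⟩
      0ℚ                                      ∎

  disc-W : ∀ ε → ε ≡ + 1 ⊎ ε ≡ -[1+ 0 ] → a ℕ.* a ≡ b ℕ.* b ℕ.* d ℕ.+ c ℕ.* c ℕ.* d
    → Disc.disc a b d (W ε) ≡ A ℚ.* A ℚ.* D
  disc-W ε ±1 hyp = begin
    Disc.disc a b d (W ε)
      ≡⟨ disc≡det-Tr*det² a b d (W ε) ⟩
    det 4 (Tr-matrix a b d) ℚ.* (det 4 CW ℚ.* det 4 CW)
      ≡⟨ cong₂ (λ t x → t ℚ.* (x ℚ.* x)) (det-traceMatrix A B D) (det-coordinates-W ε) ⟩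
    (+ 256 / 1) ℚ.* D ℚ.* D ℚ.* (A ℚ.* A ℚ.- B ℚ.* B ℚ.* D) ℚ.* (X ℚ.* X)
      ≡⟨ discriminant-value A B C D (ℤ→ℚ ε) r (sign-square ε ±1) r*C*D≡-A (A²≡B²D+C²D hyp) ⟩
    A ℚ.* A ℚ.* D
      ∎
    where
    open ≡-Reasoning
    CW : Matrix 4
    CW = coordinates a b d (W ε)
    X : ℚ
    X = ℚ.- ((+ 1 / 16) ℚ.* ℤ→ℚ ε ℚ.* r)

open import Data.Nat using (_+_; _*_; _%_)

mainTheorem3 : (a b c d : ℕ) → .{{_ : NonZero a}} → .{{_ : NonZero b}}
    → .{{_ : NonZero c}} → .{{_ : NonZero d}}
    → d % 4 ≡ 1 → SquareFree d
    → a * a ≡ b * b * d + c * c * d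
    → Arith.IsField a b d
    → (ε : ℤ) → (ε ≡ + 1 ⊎ ε ≡ -[1+ 0 ])
    → Arith.IsIntegralBasis a b d (Basis.W a b c d ε)
    → (w : Fin 4 → K) → Arith.IsIntegralBasis a b d w
    → Disc.disc a b d w ≡ ℤ→ℚ (+ (a * a * d))
mainTheorem3 a b c d {{a≢0}} {{_}} {{c≢0}} {{d≢0}} _ _ a²≡b²d+c²d _ ε ±1 W-basis w w-basis = begin
  Disc.disc a b d w      ≡⟨ disc-invariant a b d {W ε} {w} W-basis w-basis (det-coordinates-W≢0 ε ±1) ⟩
  Disc.disc a b d (W ε)  ≡⟨ disc-W ε ±1 a²≡b²d+c²d ⟩
  A ℚ.* A ℚ.* D          ≡⟨ IntegerCast.ℤ→ℚ-square-* a d ⟨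
  ℤ→ℚ (+ (a * a * d))    ∎
  where
  open import Data.Rational as ℚ using ()
  open import Relation.Binary.PropositionalEquality using (module ≡-Reasoning)
  open ≡-Reasoning
  open Discriminant using (disc-invariant)
  open CandidateBasis a b c d {{a≢0}} {{c≢0}} {{d≢0}}
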